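{- Let $V$ be a $\underline{\lambda}$-space over $k$. Suppose that for all $m,n$, every $(m,n)$-formula satisfying (LI) is equivalent modulo $\mathfrak{Th}(V)$ to a formula without quantifiers over vector variables. Then $V$ has vector-quantifier elimination, i.e., every formula of $\mathcal{L}_{\underline{\lambda}}$ is equivalent modulo $\mathfrak{Th}(V)$ to a formula without quantifiers over vector variables.
   Context: $k$ is a field of characteristic $0$, $\underline{\lambda}=[\lambda_1,\ldots,\lambda_r]$ a tuple of partitions; a $\underline{\lambda}$-space is a $k$-vector space with a linear map $\mathbf{S}_{\lambda_i}(V)\to k$ for each $i$. $\mathcal{L}_{\underline{\lambda}}$ is the two-sorted language (scalars, vectors) with scalar $+,\cdot$, constants for elements of $k$, scalar multiplication, vector addition, a zero-vector constant $\mathbf{0}$, and scalar-valued function symbols $\omega_i$ of $|\lambda_i|$ vector arguments interpreted on $k\amalg V$ by the multilinear maps encoding the forms. $\mathfrak{Th}(V)$ is the set of sentences true in $k\amalg V$; formulas are equivalent modulo it if the sentence universally quantifying their biconditional belongs to it. An $(m,n)$-formula $\phi(\underline{\alpha},\underline{x})$ ($m$ free scalar, $n$ free vector variables) satisfies (LI) if $\phi(\underline{a},\underline{v})$ implies that $(v_1,\ldots,v_n)$ is linearly independent. -}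

module Defs where

open import Level using (Level; _⊔_) renaming (suc to lsuc)
open import Data.Nat as ℕ using (ℕ; zero; suc; _≥_; _<_)
open import Data.Nat.Properties using () renaming (_≟_ to _≟ℕ_)
open import Data.Bool using (Bool; true; false; _∧_; _∨_; not; if_then_else_)
open import Data.Fin using (Fin; zero; suc; splitAt; toℕ)
open import Data.Fin.Properties using (_≟_)
open import Data.Sum using (inj₁; inj₂)
open import Data.Product using (Σ; ∃-syntax; _×_; _,_)
open import Data.List as List using (List; []; _∷_; filter; concatMap; allFin; foldr; length)
open import Data.List.Relation.Unary.All using (All)
open import Data.List.Relation.Unary.Linked using (Linked)
open import Data.Vec.Functional using (Vector) renaming (_∷_ to _∷ᶠ_)
open import Data.Empty using (⊥)
open import Function using (_∘_; _⇔_)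
open import Relation.Nullary using (¬_)
open import Relation.Nullary.Decidable using (⌊_⌋)
open import Relation.Binary.PropositionalEquality using (_≡_)
open import Algebra.Bundles using (CommutativeRing)
open import Algebra.Module.Bundles using (Module)

record Field (c ℓ : Level) : Set (lsuc (c ⊔ ℓ)) where
  field
    commutativeRing : CommutativeRing c ℓ
  open CommutativeRing commutativeRing public
  field
    0≉1     : ¬ (0# ≈ 1#)
    inverse : ∀ x → ¬ (x ≈ 0#) → ∃[ y ] (x * y ≈ 1#)

module _ {c ℓ} (K : Field c ℓ) where
  open Field K using (Carrier; _≈_; _+_; 0#; 1#)

  fromℕ : ℕ → Carrier
  fromℕ zero    = 0#
  fromℕ (suc n) = 1# + fromℕ n

  CharZero : Set ℓ
  CharZero = ∀ n → ¬ (fromℕ (suc n) ≈ 0#)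

IsPartition : List ℕ → Set
IsPartition p = Linked _≥_ p × All (0 <_) p

size : List ℕ → ℕ
size []       = 0
size (r ∷ rs) = r ℕ.+ size rs

-- boxes of λ are numbered 0,…,|λ|-1 row by row;
-- rowOf / colOf give the row and column of a box
rowOf : (p : List ℕ) → Fin (size p) → ℕ
rowOf (r ∷ rs) i with splitAt r i
... | inj₁ j = 0
... | inj₂ k = suc (rowOf rs k)

colOf : (p : List ℕ) → Fin (size p) → ℕ
colOf (r ∷ rs) i with splitAt r i
... | inj₁ j = toℕ j
... | inj₂ k = colOf rs k

allB : ∀ {n} → (Fin n → Bool) → Bool
allB {zero}  f = true
allB {suc n} f = f zero ∧ allB (f ∘ suc)

countB : ∀ {n} → (Fin n → Bool) → ℕ
countB {zero}  f = 0
countB {suc n} f = (if f zero then 1 else 0) ℕ.+ countB (f ∘ suc)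

sumFin : ∀ {n} → (Fin n → ℕ) → ℕ
sumFin {zero}  f = 0
sumFin {suc n} f = f zero ℕ.+ sumFin (f ∘ suc)

allFns : ∀ n m → List (Fin n → Fin m)
allFns zero    m = (λ ()) ∷ []
allFns (suc n) m = concatMap (λ a → List.map (λ f → a ∷ᶠ f) (allFns n m)) (allFin m)

isInjective : ∀ {n} → (Fin n → Fin n) → Bool
isInjective σ = allB λ i → allB λ j → ⌊ i ≟ j ⌋ ∨ not ⌊ σ i ≟ σ j ⌋

perms : ∀ n → List (Fin n → Fin n)
perms n = filter (λ σ → Data.Bool.T? (isInjective σ)) (allFns n n)
  where import Data.Bool

rowGroup : (p : List ℕ) → List (Fin (size p) → Fin (size p))
rowGroup p = filter (λ σ → Data.Bool.T? (allB λ i → ⌊ rowOf p (σ i) ≟ℕ rowOf p i ⌋)) (perms (size p))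
  where import Data.Bool

colGroup : (p : List ℕ) → List (Fin (size p) → Fin (size p))
colGroup p = filter (λ σ → Data.Bool.T? (allB λ i → ⌊ colOf p (σ i) ≟ℕ colOf p i ⌋)) (perms (size p))
  where import Data.Bool

inversions : ∀ {n} → (Fin n → Fin n) → ℕ
inversions σ = sumFin λ i → countB λ j → ⌊ toℕ i ℕ.<? toℕ j ⌋ ∧ ⌊ toℕ (σ j) ℕ.<? toℕ (σ i) ⌋

module _ {c ℓ cm ℓm} (K : Field c ℓ) (V : Module (Field.commutativeRing K) cm ℓm) where
  open Field K using (Carrier; _≈_; _+_; _*_; -_; 0#; 1#)
  open Module V using (Carrierᴹ; _≈ᴹ_; _+ᴹ_; _*ₗ_; 0ᴹ)

  signPow : ℕ → Carrier
  signPow zero    = 1#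
  signPow (suc k) = - signPow k

  sgn : ∀ {n} → (Fin n → Fin n) → Carrier
  sgn σ = signPow (inversions σ)

  sumK : List Carrier → Carrier
  sumK = foldr _+_ 0#

  update : ∀ {n} → (Fin n → Carrierᴹ) → Fin n → Carrierᴹ → Fin n → Carrierᴹ
  update v j x i = if ⌊ i ≟ j ⌋ then x else v i

  record IsMultilinear {n} (ω : (Fin n → Carrierᴹ) → Carrier) : Set (c ⊔ ℓ ⊔ cm ⊔ ℓm) where
    field
      cong    : ∀ {v w} → (∀ i → v i ≈ᴹ w i) → ω v ≈ ω w
      linear  : ∀ v j a b x y →
                ω (update v j ((a *ₗ x) +ᴹ (b *ₗ y))) ≈ (a * ω (update v j x)) + (b * ω (update v j y))

  -- composition of a form η with the Young symmetrizer c_λ = Σ_{p∈R_λ} Σ_{q∈C_λ} sgn(q) p q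
  -- acting on V^{⊗|λ|}:  (η ∘ c_λ)(v₁ ⊗ … ⊗ vₙ) = Σ_{p,q} sgn(q) η(v ∘ q ∘ p)
  youngSym : (p : List ℕ) → ((Fin (size p) → Carrierᴹ) → Carrier) → (Fin (size p) → Carrierᴹ) → Carrier
  youngSym p η v =
    sumK (List.map (λ π → sumK (List.map (λ q → sgn q * η (v ∘ q ∘ π)) (colGroup p))) (rowGroup p))

  -- multilinear forms coming from linear maps S_λ(V) = c_λ V^{⊗|λ|} → K :
  -- exactly the forms η ∘ c_λ with η multilinear
  IsSchurForm : (p : List ℕ) → ((Fin (size p) → Carrierᴹ) → Carrier) → Set (c ⊔ ℓ ⊔ cm ⊔ ℓm)
  IsSchurForm p ω = IsMultilinear ω ×
    (∃[ η ] (IsMultilinear η × (∀ v → ω v ≈ youngSym p η v)))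

  lincomb : ∀ {n} → (Fin n → Carrier) → (Fin n → Carrierᴹ) → Carrierᴹ
  lincomb {zero}  a v = 0ᴹ
  lincomb {suc n} a v = (a zero *ₗ v zero) +ᴹ lincomb (a ∘ suc) (v ∘ suc)

  LinearlyIndependent : ∀ {n} → (Fin n → Carrierᴹ) → Set (c ⊔ ℓ ⊔ ℓm)
  LinearlyIndependent v = ∀ a → lincomb a v ≈ᴹ 0ᴹ → ∀ j → a j ≈ 0#

-- λ-spaces:  a vector space V with, for each i, a linear map S_{λᵢ}(V) → k,
-- encoded by the multilinear form ωᵢ on V^{|λᵢ|}

record LambdaSpace {c ℓ} (K : Field c ℓ) {r : ℕ} (λs : Fin r → List ℕ) (cm ℓm : Level)
       : Set (c ⊔ ℓ ⊔ lsuc (cm ⊔ ℓm)) where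
  field
    space  : Module (Field.commutativeRing K) cm ℓm
    ω      : (i : Fin r) → (Fin (size (λs i)) → Module.Carrierᴹ space) → Field.Carrier K
    ω-schur : ∀ i → IsSchurForm K space (λs i) (ω i)

-- The two-sorted language L_λ (de Bruijn variables: m scalar, n vector)

module Syntax {c} (Scalars : Set c) {r : ℕ} (λs : Fin r → List ℕ) where

  mutual
    data STm (m n : ℕ) : Set c where
      svar  : Fin m → STm m n
      const : Scalars → STm m n
      _⊕_   : STm m n → STm m n → STm m n
      _⊗_   : STm m n → STm m n → STm m n
      app   : (i : Fin r) → (Fin (size (λs i)) → VTm m n) → STm m n

    data VTm (m n : ℕ) : Set c where
      vvar  : Fin n → VTm m n
      𝟎     : VTm m n
      _⊞_   : VTm m n → VTm m n → VTm m n
      _⊙_   : STm m n → VTm m n → VTm m n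

  data Fm : ℕ → ℕ → Set c where
    _=ₛ_  : ∀ {m n} → STm m n → STm m n → Fm m n
    _=ᵥ_  : ∀ {m n} → VTm m n → VTm m n → Fm m n
    ⊥̇     : ∀ {m n} → Fm m n
    ¬̇_    : ∀ {m n} → Fm m n → Fm m n
    _∧̇_   : ∀ {m n} → Fm m n → Fm m n → Fm m n
    _∨̇_   : ∀ {m n} → Fm m n → Fm m n → Fm m n
    _⇒̇_   : ∀ {m n} → Fm m n → Fm m n → Fm m n
    ∃ₛ ∀ₛ : ∀ {m n} → Fm (suc m) n → Fm m n
    ∃ᵥ ∀ᵥ : ∀ {m n} → Fm m (suc n) → Fm m n

  data NoVecQuant : ∀ {m n} → Fm m n → Set c where
    eqs  : ∀ {m n} (s t : STm m n) → NoVecQuant (s =ₛ t)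
    eqv  : ∀ {m n} (s t : VTm m n) → NoVecQuant (s =ᵥ t)
    bot  : ∀ {m n} → NoVecQuant (⊥̇ {m} {n})
    neg  : ∀ {m n} {φ : Fm m n} → NoVecQuant φ → NoVecQuant (¬̇ φ)
    conj : ∀ {m n} {φ ψ : Fm m n} → NoVecQuant φ → NoVecQuant ψ → NoVecQuant (φ ∧̇ ψ)
    disj : ∀ {m n} {φ ψ : Fm m n} → NoVecQuant φ → NoVecQuant ψ → NoVecQuant (φ ∨̇ ψ)
    impl : ∀ {m n} {φ ψ : Fm m n} → NoVecQuant φ → NoVecQuant ψ → NoVecQuant (φ ⇒̇ ψ)
    exs  : ∀ {m n} {φ : Fm (suc m) n} → NoVecQuant φ → NoVecQuant (∃ₛ φ)
    alls : ∀ {m n} {φ : Fm (suc m) n} → NoVecQuant φ → NoVecQuant (∀ₛ φ)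

module Semantics {c ℓ} {K : Field c ℓ} {r : ℕ} {λs : Fin r → List ℕ} {cm ℓm}
                 (Vλ : LambdaSpace K λs cm ℓm) where
  open Field K using (Carrier; _≈_; _+_; _*_)
  open LambdaSpace Vλ
  open Module space using (Carrierᴹ; _≈ᴹ_; _+ᴹ_; _*ₗ_; 0ᴹ)
  open Syntax Carrier λs public

  mutual
    ⟦_⟧ₛ : ∀ {m n} → STm m n → (Fin m → Carrier) → (Fin n → Carrierᴹ) → Carrier
    ⟦ svar i ⟧ₛ a v = a i
    ⟦ const x ⟧ₛ a v = x
    ⟦ s ⊕ t ⟧ₛ a v = ⟦ s ⟧ₛ a v + ⟦ t ⟧ₛ a v
    ⟦ s ⊗ t ⟧ₛ a v = ⟦ s ⟧ₛ a v * ⟦ t ⟧ₛ a v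
    ⟦ app i ts ⟧ₛ a v = ω i (λ j → ⟦ ts j ⟧ᵥ a v)

    ⟦_⟧ᵥ : ∀ {m n} → VTm m n → (Fin m → Carrier) → (Fin n → Carrierᴹ) → Carrierᴹ
    ⟦ vvar i ⟧ᵥ a v = v i
    ⟦ 𝟎 ⟧ᵥ a v = 0ᴹ
    ⟦ s ⊞ t ⟧ᵥ a v = ⟦ s ⟧ᵥ a v +ᴹ ⟦ t ⟧ᵥ a v
    ⟦ s ⊙ t ⟧ᵥ a v = ⟦ s ⟧ₛ a v *ₗ ⟦ t ⟧ᵥ a v

  Sat : ∀ {m n} → Fm m n → (Fin m → Carrier) → (Fin n → Carrierᴹ) → Set (c ⊔ ℓ ⊔ cm ⊔ ℓm)
  Sat (s =ₛ t) a v = Level.Lift (c ⊔ cm ⊔ ℓm) (⟦ s ⟧ₛ a v ≈ ⟦ t ⟧ₛ a v)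
  Sat (s =ᵥ t) a v = Level.Lift (c ⊔ ℓ ⊔ cm) (⟦ s ⟧ᵥ a v ≈ᴹ ⟦ t ⟧ᵥ a v)
  Sat ⊥̇ a v = Level.Lift _ ⊥
  Sat (¬̇ φ) a v = ¬ Sat φ a v
  Sat (φ ∧̇ ψ) a v = Sat φ a v × Sat ψ a v
  Sat (φ ∨̇ ψ) a v = Sat φ a v Data.Sum.⊎ Sat ψ a v
  Sat (φ ⇒̇ ψ) a v = Sat φ a v → Sat ψ a v
  Sat (∃ₛ φ) a v = Σ Carrier λ x → Sat φ (x ∷ᶠ a) v
  Sat (∀ₛ φ) a v = (x : Carrier) → Sat φ (x ∷ᶠ a) v
  Sat (∃ᵥ φ) a v = Σ Carrierᴹ λ x → Sat φ a (x ∷ᶠ v)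
  Sat (∀ᵥ φ) a v = (x : Carrierᴹ) → Sat φ a (x ∷ᶠ v)

  EquivModTh : ∀ {m n} → Fm m n → Fm m n → Set (c ⊔ ℓ ⊔ cm ⊔ ℓm)
  EquivModTh φ ψ = ∀ a v → Sat φ a v ⇔ Sat ψ a v

  SatisfiesLI : ∀ {m n} → Fm m n → Set (c ⊔ ℓ ⊔ cm ⊔ ℓm)
  SatisfiesLI φ = ∀ a v → Sat φ a v → LinearlyIndependent K space v

  VQFEquivalent : ∀ {m n} → Fm m n → Set (c ⊔ ℓ ⊔ cm ⊔ ℓm)
  VQFEquivalent φ = ∃[ ψ ] (NoVecQuant ψ × EquivModTh φ ψ)

  HasVQE : Set (c ⊔ ℓ ⊔ cm ⊔ ℓm)
  HasVQE = ∀ m n (φ : Fm m n) → VQFEquivalent φ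

-- Induct on the number of free vectors not yet known to be linearly independent. Suppose φ forces
-- the vectors u to be independent and let w be one more free vector. Either w, u are independent,
-- and w joins the independent block, or some relation e₀ w + Σ eⱼ uⱼ = 0 has e₀ ≠ 0. In that case
-- w is determined by e and u, so φ is equivalent to
--   ∃e (e₀ ≠ 0 ∧ e₀ w + Σ eⱼ uⱼ = 0 ∧ ∃x (e₀ x + Σ eⱼ uⱼ = 0 ∧ φ[x/w])),
-- where the inner formula no longer mentions w and still forces u to be independent. Only scalar
-- quantifiers are introduced; deciding between the two cases uses excluded middle.
module Submission where

open import Defs
open import Level using (Level; _⊔_; Lift; lift; lower)
open import Data.Nat using (ℕ; zero; suc; _+_)
open import Data.Nat.Properties using (+-identityʳ)
open import Data.Fin as Fin using (Fin; zero; suc; _↑ˡ_; _↑ʳ_; splitAt; join; cast)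
open import Data.Fin.Properties using (splitAt-↑ʳ; splitAt-join; join-splitAt; cast-involutive)
open import Data.List using (List)
open import Data.Sum using (inj₁; inj₂; [_,_]′)
import Data.Sum as Sum
open import Data.Sum.Properties using ([,]-map; [,]-∘)
open import Data.Product using (Σ; _,_; proj₁; proj₂)
open import Data.Product.Function.NonDependent.Propositional using (_×-⇔_)
open import Data.Sum.Function.Propositional using (_⊎-⇔_)
open import Data.Vec.Functional using () renaming (_∷_ to _∷ᶠ_)
open import Function using (id; _∘_; _⇔_; mk⇔; Equivalence)
open import Function.Properties.Equivalence using ()
  renaming (refl to ⇔-refl; trans to ⇔-trans; sym to ⇔-sym)
open import Function.Related.TypeIsomorphisms using (→-cong-⇔; ¬-cong-⇔)
open import Relation.Binary.Bundles using (Setoid)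
open import Relation.Nullary using (¬_; yes; no)
open import Relation.Nullary.Decidable using (map′; decidable-stable)
open import Relation.Binary.PropositionalEquality using (_≡_; refl; cong; module ≡-Reasoning)
import Relation.Binary.PropositionalEquality as ≡
open import Axiom.ExcludedMiddle using (ExcludedMiddle)
open import Algebra.Module.Bundles using (Module)
import Algebra.Module.Properties as ModuleProperties
import Relation.Binary.Reasoning.Setoid as SetoidReasoning

open Equivalence using (to; from)

∃-cong-⇔ : ∀ {a b c} {I : Set a} {A : I → Set b} {B : I → Set c} →
           (∀ x → A x ⇔ B x) → Σ I A ⇔ Σ I B
∃-cong-⇔ A⇔B = mk⇔ (λ (x , p) → x , to (A⇔B x) p) (λ (x , q) → x , from (A⇔B x) q)

∀-cong-⇔ : ∀ {a b c} {I : Set a} {A : I → Set b} {B : I → Set c} →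
           (∀ x → A x ⇔ B x) → (∀ x → A x) ⇔ (∀ x → B x)
∀-cong-⇔ A⇔B = mk⇔ (λ f x → to (A⇔B x) (f x)) (λ g x → from (A⇔B x) (g x))

Lift-⇔ : ∀ {a ℓ} {A : Set a} → Lift ℓ A ⇔ A
Lift-⇔ = mk⇔ lower lift

Lift-cong-⇔ : ∀ {a b ℓa ℓb} {A : Set a} {B : Set b} → A ⇔ B → Lift ℓa A ⇔ Lift ℓb B
Lift-cong-⇔ A⇔B = mk⇔ (lift ∘ to A⇔B ∘ lower) (lift ∘ from A⇔B ∘ lower)

module _ {a ℓ} (S : Setoid a ℓ) where
  open Setoid S using (Carrier; _≈_) renaming (refl to ≈-refl; sym to ≈-sym; trans to ≈-trans)

  ≈-cong-⇔ : ∀ {x x' y y'} → x ≈ x' → y ≈ y' → (x ≈ y) ⇔ (x' ≈ y')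
  ≈-cong-⇔ x≈x' y≈y' =
    mk⇔ (λ x≈y → ≈-trans (≈-sym x≈x') (≈-trans x≈y y≈y'))
        (λ x'≈y' → ≈-trans x≈x' (≈-trans x'≈y' (≈-sym y≈y')))

  ∷ᶠ-lift : ∀ {m m'} {ρ : Fin m → Fin m'} {u : Fin m → Carrier} {u' : Fin m' → Carrier} x →
            (∀ i → u' (ρ i) ≈ u i) → ∀ i → (x ∷ᶠ u') (Fin.lift 1 ρ i) ≈ (x ∷ᶠ u) i
  ∷ᶠ-lift x u'ρ≈u zero    = ≈-refl
  ∷ᶠ-lift x u'ρ≈u (suc i) = u'ρ≈u i

-- Unlike Data.Vec.Functional._++_, this computes by recursion on the length of the prefix,
-- so that (x ∷ᶠ e) ++ a and x ∷ᶠ (e ++ a) agree definitionally.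
_++_ : ∀ {a} {A : Set a} {p m} → (Fin p → A) → (Fin m → A) → Fin (p + m) → A
_++_ {p = zero}  e u = u
_++_ {p = suc p} e u = e zero ∷ᶠ ((e ∘ suc) ++ u)

++-↑ˡ : ∀ {a} {A : Set a} {p m} (e : Fin p → A) (u : Fin m → A) j → (e ++ u) (j ↑ˡ m) ≡ e j
++-↑ˡ e u zero    = refl
++-↑ˡ e u (suc j) = ++-↑ˡ (e ∘ suc) u j

++-↑ʳ : ∀ {a} {A : Set a} p {m} (e : Fin p → A) (u : Fin m → A) i → (e ++ u) (p ↑ʳ i) ≡ u i
++-↑ʳ zero    e u i = refl
++-↑ʳ (suc p) e u i = ++-↑ʳ p (e ∘ suc) u i

module LinearAlgebra {c ℓ cm ℓm} (K : Field c ℓ) (M : Module (Field.commutativeRing K) cm ℓm) where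
  open Field K using (Carrier; _≈_; _*_; 0#; 1#; *-comm; inverse)
    renaming (refl to ≈-refl; trans to ≈-trans)
  open Module M using (Carrierᴹ; _≈ᴹ_; _+ᴹ_; _*ₗ_; 0ᴹ; +ᴹ-cong; *ₗ-cong;
    ≈ᴹ-refl; ≈ᴹ-sym; ≈ᴹ-trans; ≈ᴹ-setoid; *ₗ-zeroˡ; +ᴹ-identityˡ; *ₗ-assoc; *ₗ-identityˡ)
  open ModuleProperties M using (inverseˡ-uniqueᴹ)

  private
    lc : ∀ {p} → (Fin p → Carrier) → (Fin p → Carrierᴹ) → Carrierᴹ
    lc = lincomb K M

    LI : ∀ {p} → (Fin p → Carrierᴹ) → Set _
    LI = LinearlyIndependent K M

  lincomb-cong : ∀ {p} {a b : Fin p → Carrier} {u v : Fin p → Carrierᴹ} →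
                 (∀ j → a j ≈ b j) → (∀ j → u j ≈ᴹ v j) → lc a u ≈ᴹ lc b v
  lincomb-cong {zero}  a≈b u≈v = ≈ᴹ-refl
  lincomb-cong {suc p} a≈b u≈v =
    +ᴹ-cong (*ₗ-cong (a≈b zero) (u≈v zero)) (lincomb-cong (a≈b ∘ suc) (u≈v ∘ suc))

  LinearlyIndependent-resp : ∀ {p} {u v : Fin p → Carrierᴹ} →
                             (∀ j → u j ≈ᴹ v j) → LI u → LI v
  LinearlyIndependent-resp u≈v li a av≈0 =
    li a (≈ᴹ-trans (lincomb-cong (λ _ → ≈-refl) u≈v) av≈0)

  *ₗ-cancelˡ : ∀ {a x y} → ¬ a ≈ 0# → a *ₗ x ≈ᴹ a *ₗ y → x ≈ᴹ y
  *ₗ-cancelˡ {a} {x} {y} a≉0 ax≈ay = begin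
    x                ≈⟨ *ₗ-identityˡ x ⟨
    1# *ₗ x          ≈⟨ *ₗ-cong b*a≈1 ≈ᴹ-refl ⟨
    (b * a) *ₗ x     ≈⟨ *ₗ-assoc b a x ⟩
    b *ₗ (a *ₗ x)    ≈⟨ *ₗ-cong ≈-refl ax≈ay ⟩
    b *ₗ (a *ₗ y)    ≈⟨ *ₗ-assoc b a y ⟨
    (b * a) *ₗ y     ≈⟨ *ₗ-cong b*a≈1 ≈ᴹ-refl ⟩
    1# *ₗ y          ≈⟨ *ₗ-identityˡ y ⟩
    y                ∎
    where
    open SetoidReasoning ≈ᴹ-setoid
    b : Carrier
    b = proj₁ (inverse a a≉0)
    b*a≈1 : b * a ≈ 1#
    b*a≈1 = ≈-trans (*-comm b a) (proj₂ (inverse a a≉0))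

  lincomb-head-unique : ∀ {p} (e : Fin (suc p) → Carrier) {x y : Carrierᴹ} {u : Fin p → Carrierᴹ} →
                        ¬ e zero ≈ 0# → lc e (x ∷ᶠ u) ≈ᴹ 0ᴹ → lc e (y ∷ᶠ u) ≈ᴹ 0ᴹ → x ≈ᴹ y
  lincomb-head-unique e e₀≉0 ex≈0 ey≈0 =
    *ₗ-cancelˡ e₀≉0 (≈ᴹ-trans (inverseˡ-uniqueᴹ _ _ ex≈0) (≈ᴹ-sym (inverseˡ-uniqueᴹ _ _ ey≈0)))

  LinearlyIndependent-∷ : ∀ {p} {w : Carrierᴹ} {u : Fin p → Carrierᴹ} → LI u →
                          (∀ e → lc e (w ∷ᶠ u) ≈ᴹ 0ᴹ → e zero ≈ 0#) → LI (w ∷ᶠ u)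
  LinearlyIndependent-∷ li head≈0 e ew≈0 zero = head≈0 e ew≈0
  LinearlyIndependent-∷ {w = w} {u} li head≈0 e ew≈0 (suc j) = li (e ∘ suc) tail≈0 j
    where
    open SetoidReasoning ≈ᴹ-setoid
    tail≈0 : lc (e ∘ suc) u ≈ᴹ 0ᴹ
    tail≈0 = begin
      lc (e ∘ suc) u                    ≈⟨ +ᴹ-identityˡ _ ⟨
      0ᴹ +ᴹ lc (e ∘ suc) u              ≈⟨ +ᴹ-cong (*ₗ-zeroˡ w) ≈ᴹ-refl ⟨
      (0# *ₗ w) +ᴹ lc (e ∘ suc) u       ≈⟨ +ᴹ-cong (*ₗ-cong (head≈0 e ew≈0) ≈ᴹ-refl) ≈ᴹ-refl ⟨
      (e zero *ₗ w) +ᴹ lc (e ∘ suc) u   ≈⟨ ew≈0 ⟩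
      0ᴹ                                ∎

module Renaming {c} (Scalars : Set c) {r : ℕ} (λs : Fin r → List ℕ) where
  open Syntax Scalars λs

  mutual
    renS : ∀ {m m' n n'} → (Fin m → Fin m') → (Fin n → Fin n') → STm m n → STm m' n'
    renS ρs ρv (svar i)   = svar (ρs i)
    renS ρs ρv (const x)  = const x
    renS ρs ρv (s ⊕ t)    = renS ρs ρv s ⊕ renS ρs ρv t
    renS ρs ρv (s ⊗ t)    = renS ρs ρv s ⊗ renS ρs ρv t
    renS ρs ρv (app i ts) = app i (renV ρs ρv ∘ ts)

    renV : ∀ {m m' n n'} → (Fin m → Fin m') → (Fin n → Fin n') → VTm m n → VTm m' n'
    renV ρs ρv (vvar i) = vvar (ρv i)
    renV ρs ρv 𝟎        = 𝟎
    renV ρs ρv (s ⊞ t)  = renV ρs ρv s ⊞ renV ρs ρv t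
    renV ρs ρv (s ⊙ t)  = renS ρs ρv s ⊙ renV ρs ρv t

  renF : ∀ {m m' n n'} → (Fin m → Fin m') → (Fin n → Fin n') → Fm m n → Fm m' n'
  renF ρs ρv (s =ₛ t) = renS ρs ρv s =ₛ renS ρs ρv t
  renF ρs ρv (s =ᵥ t) = renV ρs ρv s =ᵥ renV ρs ρv t
  renF ρs ρv ⊥̇        = ⊥̇
  renF ρs ρv (¬̇ φ)    = ¬̇ renF ρs ρv φ
  renF ρs ρv (φ ∧̇ ψ)  = renF ρs ρv φ ∧̇ renF ρs ρv ψ
  renF ρs ρv (φ ∨̇ ψ)  = renF ρs ρv φ ∨̇ renF ρs ρv ψ
  renF ρs ρv (φ ⇒̇ ψ)  = renF ρs ρv φ ⇒̇ renF ρs ρv ψ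
  renF ρs ρv (∃ₛ φ)   = ∃ₛ (renF (Fin.lift 1 ρs) ρv φ)
  renF ρs ρv (∀ₛ φ)   = ∀ₛ (renF (Fin.lift 1 ρs) ρv φ)
  renF ρs ρv (∃ᵥ φ)   = ∃ᵥ (renF ρs (Fin.lift 1 ρv) φ)
  renF ρs ρv (∀ᵥ φ)   = ∀ᵥ (renF ρs (Fin.lift 1 ρv) φ)

  NoVecQuant-renF : ∀ {m m' n n'} (ρs : Fin m → Fin m') (ρv : Fin n → Fin n') {φ : Fm m n} →
                    NoVecQuant φ → NoVecQuant (renF ρs ρv φ)
  NoVecQuant-renF ρs ρv (eqs s t)  = eqs _ _
  NoVecQuant-renF ρs ρv (eqv s t)  = eqv _ _
  NoVecQuant-renF ρs ρv bot        = bot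
  NoVecQuant-renF ρs ρv (neg p)    = neg (NoVecQuant-renF ρs ρv p)
  NoVecQuant-renF ρs ρv (conj p q) = conj (NoVecQuant-renF ρs ρv p) (NoVecQuant-renF ρs ρv q)
  NoVecQuant-renF ρs ρv (disj p q) = disj (NoVecQuant-renF ρs ρv p) (NoVecQuant-renF ρs ρv q)
  NoVecQuant-renF ρs ρv (impl p q) = impl (NoVecQuant-renF ρs ρv p) (NoVecQuant-renF ρs ρv q)
  NoVecQuant-renF ρs ρv (exs p)    = exs (NoVecQuant-renF (Fin.lift 1 ρs) ρv p)
  NoVecQuant-renF ρs ρv (alls p)   = alls (NoVecQuant-renF (Fin.lift 1 ρs) ρv p)

  ∃ₛ⋯ : ∀ p {m n} → Fm (p + m) n → Fm m n
  ∃ₛ⋯ zero    φ = φ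
  ∃ₛ⋯ (suc p) φ = ∃ₛ⋯ p (∃ₛ φ)

  lincombTm : ∀ {p m n} → (Fin p → STm m n) → (Fin p → VTm m n) → VTm m n
  lincombTm {zero}  cs ts = 𝟎
  lincombTm {suc p} cs ts = (cs zero ⊙ ts zero) ⊞ lincombTm (cs ∘ suc) (ts ∘ suc)

-- In Fin (suc (n + k)), index zero is the vector w to be eliminated and the last k indices are
-- the vectors known to be linearly independent.
module HeadToLIBlock (n k : ℕ) where
  liBlock : Fin (suc k) → Fin (suc (n + k))
  liBlock = zero ∷ᶠ (suc ∘ (n ↑ʳ_))

  moveHead : Fin (suc (n + k)) → Fin (n + suc k)
  moveHead zero    = n ↑ʳ zero
  moveHead (suc i) = join n (suc k) (Sum.map₂ suc (splitAt n i))

  moveHead⁻¹ : Fin (n + suc k) → Fin (suc (n + k))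
  moveHead⁻¹ = [ suc ∘ (_↑ˡ k) , liBlock ]′ ∘ splitAt n

  moveHead⁻¹-moveHead : ∀ i → moveHead⁻¹ (moveHead i) ≡ i
  moveHead⁻¹-moveHead zero    = cong [ suc ∘ (_↑ˡ k) , liBlock ]′ (splitAt-↑ʳ n (suc k) zero)
  moveHead⁻¹-moveHead (suc i) = begin
    [ suc ∘ (_↑ˡ k) , liBlock ]′ (splitAt n (join n (suc k) (Sum.map₂ suc (splitAt n i))))
      ≡⟨ cong [ suc ∘ (_↑ˡ k) , liBlock ]′ (splitAt-join n (suc k) (Sum.map₂ suc (splitAt n i))) ⟩
    [ suc ∘ (_↑ˡ k) , liBlock ]′ (Sum.map₂ suc (splitAt n i))
      ≡⟨ [,]-map (splitAt n i) ⟩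
    [ suc ∘ (_↑ˡ k) , suc ∘ (n ↑ʳ_) ]′ (splitAt n i)
      ≡⟨ [,]-∘ suc (splitAt n i) ⟨
    suc (join n k (splitAt n i))
      ≡⟨ cong suc (join-splitAt n k i) ⟩
    suc i ∎
    where open ≡-Reasoning

  moveHead-↑ʳ : ∀ j → moveHead (suc (n ↑ʳ j)) ≡ n ↑ʳ suc j
  moveHead-↑ʳ j = cong (join n (suc k) ∘ Sum.map₂ suc) (splitAt-↑ʳ n k j)

module Interpretation {c ℓ} {K : Field c ℓ} {r : ℕ} {λs : Fin r → List ℕ} {cm ℓm}
                      (V : LambdaSpace K λs cm ℓm) where
  open Field K using (Carrier; _≈_; setoid; +-cong; *-cong) renaming (refl to ≈-refl)
  open LambdaSpace V
  open Module space using (Carrierᴹ; _≈ᴹ_; _+ᴹ_; _*ₗ_; +ᴹ-cong; *ₗ-cong; ≈ᴹ-refl; ≈ᴹ-setoid)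
  open Semantics V
  open Renaming Carrier λs

  module _ {m m' n n'} (ρs : Fin m → Fin m') (ρv : Fin n → Fin n')
           {a : Fin m → Carrier} {a' : Fin m' → Carrier}
           {v : Fin n → Carrierᴹ} {v' : Fin n' → Carrierᴹ}
           (a'ρs≈a : ∀ i → a' (ρs i) ≈ a i) (v'ρv≈v : ∀ i → v' (ρv i) ≈ᴹ v i) where
    mutual
      ⟦renS⟧ : (t : STm m n) → ⟦ renS ρs ρv t ⟧ₛ a' v' ≈ ⟦ t ⟧ₛ a v
      ⟦renS⟧ (svar i)   = a'ρs≈a i
      ⟦renS⟧ (const x)  = ≈-refl
      ⟦renS⟧ (s ⊕ t)    = +-cong (⟦renS⟧ s) (⟦renS⟧ t)
      ⟦renS⟧ (s ⊗ t)    = *-cong (⟦renS⟧ s) (⟦renS⟧ t)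
      ⟦renS⟧ (app i ts) = IsMultilinear.cong (proj₁ (ω-schur i)) (⟦renV⟧ ∘ ts)

      ⟦renV⟧ : (t : VTm m n) → ⟦ renV ρs ρv t ⟧ᵥ a' v' ≈ᴹ ⟦ t ⟧ᵥ a v
      ⟦renV⟧ (vvar i) = v'ρv≈v i
      ⟦renV⟧ 𝟎        = ≈ᴹ-refl
      ⟦renV⟧ (s ⊞ t)  = +ᴹ-cong (⟦renV⟧ s) (⟦renV⟧ t)
      ⟦renV⟧ (s ⊙ t)  = *ₗ-cong (⟦renS⟧ s) (⟦renV⟧ t)

  Sat-ren : ∀ {m m' n n'} (φ : Fm m n) (ρs : Fin m → Fin m') (ρv : Fin n → Fin n')
            {a : Fin m → Carrier} {a' : Fin m' → Carrier}
            {v : Fin n → Carrierᴹ} {v' : Fin n' → Carrierᴹ} →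
            (∀ i → a' (ρs i) ≈ a i) → (∀ i → v' (ρv i) ≈ᴹ v i) →
            Sat (renF ρs ρv φ) a' v' ⇔ Sat φ a v
  Sat-ren (s =ₛ t) ρs ρv as vs =
    Lift-cong-⇔ (≈-cong-⇔ setoid (⟦renS⟧ ρs ρv as vs s) (⟦renS⟧ ρs ρv as vs t))
  Sat-ren (s =ᵥ t) ρs ρv as vs =
    Lift-cong-⇔ (≈-cong-⇔ ≈ᴹ-setoid (⟦renV⟧ ρs ρv as vs s) (⟦renV⟧ ρs ρv as vs t))
  Sat-ren ⊥̇        ρs ρv as vs = ⇔-refl
  Sat-ren (¬̇ φ)    ρs ρv as vs = ¬-cong-⇔ (Sat-ren φ ρs ρv as vs)
  Sat-ren (φ ∧̇ ψ)  ρs ρv as vs = Sat-ren φ ρs ρv as vs ×-⇔ Sat-ren ψ ρs ρv as vs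
  Sat-ren (φ ∨̇ ψ)  ρs ρv as vs = Sat-ren φ ρs ρv as vs ⊎-⇔ Sat-ren ψ ρs ρv as vs
  Sat-ren (φ ⇒̇ ψ)  ρs ρv as vs = →-cong-⇔ (Sat-ren φ ρs ρv as vs) (Sat-ren ψ ρs ρv as vs)
  Sat-ren (∃ₛ φ)   ρs ρv as vs =
    ∃-cong-⇔ λ x → Sat-ren φ (Fin.lift 1 ρs) ρv (∷ᶠ-lift setoid x as) vs
  Sat-ren (∀ₛ φ)   ρs ρv as vs =
    ∀-cong-⇔ λ x → Sat-ren φ (Fin.lift 1 ρs) ρv (∷ᶠ-lift setoid x as) vs
  Sat-ren (∃ᵥ φ)   ρs ρv as vs =
    ∃-cong-⇔ λ x → Sat-ren φ ρs (Fin.lift 1 ρv) as (∷ᶠ-lift ≈ᴹ-setoid x vs)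
  Sat-ren (∀ᵥ φ)   ρs ρv as vs =
    ∀-cong-⇔ λ x → Sat-ren φ ρs (Fin.lift 1 ρv) as (∷ᶠ-lift ≈ᴹ-setoid x vs)

  Sat-renF : ∀ {m m' n n'} (φ : Fm m n) (ρs : Fin m → Fin m') (ρv : Fin n → Fin n') a v →
             Sat (renF ρs ρv φ) a v ⇔ Sat φ (a ∘ ρs) (v ∘ ρv)
  Sat-renF φ ρs ρv a v = Sat-ren φ ρs ρv (λ _ → ≈-refl) (λ _ → ≈ᴹ-refl)

  Sat-∃ₛ⋯ : ∀ p {m n} (φ : Fm (p + m) n) a v →
            Sat (∃ₛ⋯ p φ) a v ⇔ Σ (Fin p → Carrier) λ e → Sat φ (e ++ a) v
  Sat-∃ₛ⋯ zero    φ a v = mk⇔ (λ s → (λ ()) , s) proj₂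
  Sat-∃ₛ⋯ (suc p) φ a v = ⇔-trans (Sat-∃ₛ⋯ p (∃ₛ φ) a v)
    (mk⇔ (λ (e , x , s) → (x ∷ᶠ e) , s) (λ (e , s) → (e ∘ suc) , e zero , s))

  ⟦lincombTm⟧ : ∀ {p m n} (cs : Fin p → STm m n) (ts : Fin p → VTm m n) a v →
                ⟦ lincombTm cs ts ⟧ᵥ a v ≡
                lincomb K space (λ j → ⟦ cs j ⟧ₛ a v) (λ j → ⟦ ts j ⟧ᵥ a v)
  ⟦lincombTm⟧ {zero}  cs ts a v = refl
  ⟦lincombTm⟧ {suc p} cs ts a v =
    cong ((⟦ cs zero ⟧ₛ a v *ₗ ⟦ ts zero ⟧ᵥ a v) +ᴹ_) (⟦lincombTm⟧ (cs ∘ suc) (ts ∘ suc) a v)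

  -- The formulas are explicit arguments below: VQFEquivalent unfolds to the semantics,
  -- so Agda cannot recover them by unification.
  NoVecQuant⇒VQFEquivalent : ∀ {m n} {φ : Fm m n} → NoVecQuant φ → VQFEquivalent φ
  NoVecQuant⇒VQFEquivalent q = _ , q , λ a v → ⇔-refl

  VQFEquivalent-resp-⇔ : ∀ {m n} {φ : Fm m n} (ψ : Fm m n) →
                         EquivModTh φ ψ → VQFEquivalent ψ → VQFEquivalent φ
  VQFEquivalent-resp-⇔ ψ φ⇔ψ (χ , q , ψ⇔χ) = χ , q , λ a v → ⇔-trans (φ⇔ψ a v) (ψ⇔χ a v)

  VQFEquivalent-∧̇ : ∀ {m n} (φ ψ : Fm m n) →
                    VQFEquivalent φ → VQFEquivalent ψ → VQFEquivalent (φ ∧̇ ψ)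
  VQFEquivalent-∧̇ φ ψ (χ , q , φ⇔χ) (χ' , q' , ψ⇔χ') =
    χ ∧̇ χ' , conj q q' , λ a v → φ⇔χ a v ×-⇔ ψ⇔χ' a v

  VQFEquivalent-∨̇ : ∀ {m n} (φ ψ : Fm m n) →
                    VQFEquivalent φ → VQFEquivalent ψ → VQFEquivalent (φ ∨̇ ψ)
  VQFEquivalent-∨̇ φ ψ (χ , q , φ⇔χ) (χ' , q' , ψ⇔χ') =
    χ ∨̇ χ' , disj q q' , λ a v → φ⇔χ a v ⊎-⇔ ψ⇔χ' a v

  VQFEquivalent-∃ₛ⋯ : ∀ p {m n} (φ : Fm (p + m) n) → VQFEquivalent φ → VQFEquivalent (∃ₛ⋯ p φ)
  VQFEquivalent-∃ₛ⋯ zero    φ h = h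
  VQFEquivalent-∃ₛ⋯ (suc p) φ (χ , q , φ⇔χ) =
    VQFEquivalent-∃ₛ⋯ p (∃ₛ φ) (∃ₛ χ , exs q , λ a v → ∃-cong-⇔ λ x → φ⇔χ (x ∷ᶠ a) v)

  VQFEquivalent-renF : ∀ {m m' n n'} (ρs : Fin m → Fin m') (ρv : Fin n → Fin n') (φ : Fm m n) →
                       VQFEquivalent φ → VQFEquivalent (renF ρs ρv φ)
  VQFEquivalent-renF ρs ρv φ (χ , q , φ⇔χ) = renF ρs ρv χ , NoVecQuant-renF ρs ρv q , λ a v →
    ⇔-trans (Sat-renF φ ρs ρv a v) (⇔-trans (φ⇔χ (a ∘ ρs) (v ∘ ρv)) (⇔-sym (Sat-renF χ ρs ρv a v)))

  VQFEquivalent-unrenFᵥ : ∀ {m n n'} (ρ : Fin n → Fin n') (σ : Fin n' → Fin n) →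
                          (∀ i → σ (ρ i) ≡ i) →
                          (φ : Fm m n) → VQFEquivalent (renF id ρ φ) → VQFEquivalent φ
  VQFEquivalent-unrenFᵥ ρ σ σρ≡id φ h =
    VQFEquivalent-resp-⇔ _ φ⇔φρσ (VQFEquivalent-renF id σ (renF id ρ φ) h)
    where
    φ⇔φρσ : EquivModTh φ (renF id σ (renF id ρ φ))
    φ⇔φρσ a v = ⇔-sym (⇔-trans (Sat-renF _ id σ a v)
      (Sat-ren φ id ρ (λ _ → ≈-refl) (λ i → Setoid.reflexive ≈ᴹ-setoid (cong v (σρ≡id i)))))

module Elimination {c ℓ} {K : Field c ℓ} {r : ℕ} {λs : Fin r → List ℕ} {cm ℓm}
                   (V : LambdaSpace K λs cm ℓm) (em : ExcludedMiddle (c ⊔ ℓ ⊔ cm ⊔ ℓm)) where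
  open Field K using (Carrier; _≈_; 0#; setoid)
  open LambdaSpace V using (space)
  open Module space using (Carrierᴹ; _≈ᴹ_; 0ᴹ; ≈ᴹ-refl; ≈ᴹ-trans; ≈ᴹ-setoid)
  open Setoid setoid using () renaming (reflexive to ≈-reflexive)
  open Setoid ≈ᴹ-setoid using () renaming (reflexive to ≈ᴹ-reflexive)
  open Semantics V
  open Renaming Carrier λs
  open Interpretation V
  open LinearAlgebra K space

  private
    LI : ∀ {p} → (Fin p → Carrierᴹ) → Set _
    LI = LinearlyIndependent K space

  ≈-stable : ∀ {x y} → ¬ ¬ x ≈ y → x ≈ y
  ≈-stable {x} {y} = decidable-stable (map′ lower lift (em {Lift (c ⊔ ℓ ⊔ cm ⊔ ℓm) (x ≈ y)}))

  -- The first k+1 scalar variables are the coefficients e of a relation e₀ w + Σ eⱼ uⱼ = 0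
  -- between w and the independent vectors u.
  module SplitOnSpan (n k m : ℕ) (φ : Fm m (suc n + k)) where
    open HeadToLIBlock n k

    coefficient : Fin (suc k) → STm (suc k + m) (suc (n + k))
    coefficient j = svar (j ↑ˡ m)

    relation : Fm (suc k + m) (suc (n + k))
    relation = lincombTm coefficient (vvar ∘ liBlock) =ᵥ 𝟎

    spanWitness : Fm (suc k + m) (suc (n + k))
    spanWitness = (¬̇ (svar zero =ₛ const 0#)) ∧̇ relation

    spanWitness-NoVecQuant : NoVecQuant spanWitness
    spanWitness-NoVecQuant = conj (neg (eqs _ _)) (eqv _ _)

    inSpan : Fm m (suc (n + k))
    inSpan = ∃ₛ⋯ (suc k) spanWitness

    independentPart : Fm m (suc (n + k))
    independentPart = φ ∧̇ (¬̇ inSpan)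

    eliminated : Fm (suc k + m) (n + k)
    eliminated = ∃ᵥ (relation ∧̇ renF (suc k ↑ʳ_) id φ)

    dependentPart : Fm m (suc (n + k))
    dependentPart = ∃ₛ⋯ (suc k) (spanWitness ∧̇ renF id suc eliminated)

    Sat-relation : ∀ e a w → Sat relation (e ++ a) w ⇔ (lincomb K space e (w ∘ liBlock) ≈ᴹ 0ᴹ)
    Sat-relation e a w = ⇔-trans Lift-⇔ (≈-cong-⇔ ≈ᴹ-setoid ⟦lincombTm⟧≈ ≈ᴹ-refl)
      where
      ⟦lincombTm⟧≈ : ⟦ lincombTm coefficient (vvar ∘ liBlock) ⟧ᵥ (e ++ a) w ≈ᴹ
                     lincomb K space e (w ∘ liBlock)
      ⟦lincombTm⟧≈ = ≈ᴹ-trans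
        (≈ᴹ-reflexive (⟦lincombTm⟧ coefficient (vvar ∘ liBlock) (e ++ a) w))
        (lincomb-cong {u = w ∘ liBlock} (≈-reflexive ∘ ++-↑ˡ e a) (λ _ → ≈ᴹ-refl))

    Sat-shifted : ∀ (e : Fin (suc k) → Carrier) a {x} v → x ≈ᴹ v zero →
                  Sat (renF (suc k ↑ʳ_) id φ) (e ++ a) (x ∷ᶠ (v ∘ suc)) ⇔ Sat φ a v
    Sat-shifted e a v x≈v₀ = Sat-ren φ (suc k ↑ʳ_) id (≈-reflexive ∘ ++-↑ʳ (suc k) e a) x∷v≈v
      where
      x∷v≈v : ∀ i → (_ ∷ᶠ (v ∘ suc)) i ≈ᴹ v i
      x∷v≈v zero    = x≈v₀
      x∷v≈v (suc i) = ≈ᴹ-refl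

    splitOnSpan : EquivModTh φ (independentPart ∨̇ dependentPart)
    splitOnSpan a v = mk⇔ forth back
      where
      forth : Sat φ a v → Sat (independentPart ∨̇ dependentPart) a v
      forth sφ with em {Sat inSpan a v}
      ... | no ¬span = inj₁ (sφ , ¬span)
      ... | yes span =
        let (e , e₀≉0 , rel) = to (Sat-∃ₛ⋯ (suc k) spanWitness a v) span
            relᵥ = from (Sat-relation e a (v zero ∷ᶠ (v ∘ suc))) (to (Sat-relation e a v) rel)
        in inj₂ (from (Sat-∃ₛ⋯ (suc k) _ a v)
             (e , (e₀≉0 , rel) , from (Sat-renF eliminated id suc (e ++ a) v)
                                    (v zero , relᵥ , from (Sat-shifted e a v ≈ᴹ-refl) sφ)))

      back : Sat (independentPart ∨̇ dependentPart) a v → Sat φ a v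
      back (inj₁ (sφ , _)) = sφ
      back (inj₂ s) =
        let (e , (e₀≉0 , rel) , s') = to (Sat-∃ₛ⋯ (suc k) _ a v) s
            (x , relₓ , sφₓ) = to (Sat-renF eliminated id suc (e ++ a) v) s'
            x≈v₀ = lincomb-head-unique e (e₀≉0 ∘ lift)
                     (to (Sat-relation e a (x ∷ᶠ (v ∘ suc))) relₓ) (to (Sat-relation e a v) rel)
        in to (Sat-shifted e a v x≈v₀) sφₓ

    module _ (φ-LI : ∀ a v → Sat φ a v → LI (v ∘ (suc n ↑ʳ_))) where
      independentPart-LI : ∀ a v → Sat (renF id moveHead independentPart) a v →
                           LI (v ∘ (n ↑ʳ_))
      independentPart-LI a v s =
        LinearlyIndependent-resp w∷u≈v (LinearlyIndependent-∷ (φ-LI a w sφ) head≈0)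
        where
        w = v ∘ moveHead
        sφ = proj₁ (to (Sat-renF independentPart id moveHead a v) s)
        ¬span = proj₂ (to (Sat-renF independentPart id moveHead a v) s)
        head≈0 : ∀ e → lincomb K space e (w ∘ liBlock) ≈ᴹ 0ᴹ → e zero ≈ 0#
        head≈0 e rel = ≈-stable λ e₀≉0 →
          ¬span (from (Sat-∃ₛ⋯ (suc k) spanWitness a w)
                  (e , e₀≉0 ∘ lower , from (Sat-relation e a w) rel))
        w∷u≈v : ∀ j → (w zero ∷ᶠ (w ∘ liBlock ∘ suc)) j ≈ᴹ v (n ↑ʳ j)
        w∷u≈v zero    = ≈ᴹ-refl
        w∷u≈v (suc j) = ≈ᴹ-reflexive (cong v (moveHead-↑ʳ j))

      eliminated-LI : ∀ a v → Sat eliminated a v → LI (v ∘ (n ↑ʳ_))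
      eliminated-LI a v (x , _ , sφ) =
        φ-LI _ (x ∷ᶠ v) (to (Sat-renF φ (suc k ↑ʳ_) id a (x ∷ᶠ v)) sφ)

  module _ (hyp : ∀ m n (φ : Fm m n) → SatisfiesLI φ → VQFEquivalent φ) where
    VQFEquivalent-LI-suffix : ∀ n {m k} (φ : Fm m (n + k)) →
                              (∀ a v → Sat φ a v → LI (v ∘ (n ↑ʳ_))) → VQFEquivalent φ
    VQFEquivalent-LI-suffix zero    φ φ-LI = hyp _ _ φ φ-LI
    VQFEquivalent-LI-suffix (suc n) {m} {k} φ φ-LI =
      VQFEquivalent-resp-⇔ (independentPart ∨̇ dependentPart) splitOnSpan
        (VQFEquivalent-∨̇ independentPart dependentPart independent dependent)
      where
      open HeadToLIBlock n k
      open SplitOnSpan n k m φ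

      independent : VQFEquivalent independentPart
      independent = VQFEquivalent-unrenFᵥ moveHead moveHead⁻¹ moveHead⁻¹-moveHead independentPart
        (VQFEquivalent-LI-suffix n (renF id moveHead independentPart) (independentPart-LI φ-LI))

      dependent : VQFEquivalent dependentPart
      dependent = VQFEquivalent-∃ₛ⋯ (suc k) (spanWitness ∧̇ renF id suc eliminated)
        (VQFEquivalent-∧̇ spanWitness (renF id suc eliminated)
          (NoVecQuant⇒VQFEquivalent spanWitness-NoVecQuant)
          (VQFEquivalent-renF id suc eliminated
            (VQFEquivalent-LI-suffix n eliminated (eliminated-LI φ-LI))))

    hasVQE : HasVQE
    hasVQE m n φ =
      VQFEquivalent-unrenFᵥ (cast n≡n+0) (cast (≡.sym n≡n+0)) (cast-involutive (≡.sym n≡n+0) n≡n+0) φ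
        (VQFEquivalent-LI-suffix n (renF id (cast n≡n+0) φ) λ _ _ _ _ _ ())
      where
      n≡n+0 : n ≡ n + 0
      n≡n+0 = ≡.sym (+-identityʳ n)

lemma5p21 : ∀ {c ℓ cm ℓm : Level} (K : Field c ℓ) → CharZero K →
            ∀ {r : ℕ} (λs : Fin r → List ℕ) → (∀ i → IsPartition (λs i)) →
            (V : LambdaSpace K λs cm ℓm) →
            ExcludedMiddle (c ⊔ ℓ ⊔ cm ⊔ ℓm) →
            (∀ m n (φ : Semantics.Fm V m n) → Semantics.SatisfiesLI V φ → Semantics.VQFEquivalent V φ) →
            Semantics.HasVQE V
lemma5p21 K _ λs _ V em = Elimination.hasVQE V em
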